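{- Let $s,t\ge1$, let $G=K_{s,t}$ with parts $X$ ($|X|=s$) and $Y$ ($|Y|=t$), let $q$ satisfy $q\neq-1$, $q^2(s-1)(t-1)\neq1$ and $(q+1)^2(s-1)(t-1)\neq st$, and let $\mathscr{D}$ be the $q$-distance matrix of $G$. Then $\mathscr{D}\mathscr{L}+\mathbf{I}_{s+t}=\mathds{1}_{s+t}\mathbf{x}^T$, where $\mathscr{L}$ and $\mathbf{x}$ are as defined below.
   Context: $q$ is a real or complex number (the paper calls it an indeterminate). For an integer $\alpha\ge1$, $[\alpha]=1+q+\cdots+q^{\alpha-1}$, $[0]=0$; the $q$-distance matrix has $(i,j)$ entry $[d(v_i,v_j)]$. Put $\Delta=q^2(s-1)(t-1)-1$. The vector $\mathbf{x}$ has entry $\frac{q(t-1)-1}{(q+1)\Delta}$ at each vertex of $X$ and $\frac{q(s-1)-1}{(q+1)\Delta}$ at each vertex of $Y$. The vector $\mathbf{y}$ has entry $\frac{t-1}{\Delta}$ at vertices of $X$ and $\frac{s-1}{\Delta}$ at vertices of $Y$. $\mathbf{A}$ is the matrix with $(u,v)$ entry $1/\Delta$ if $u\sim v$ and $0$ otherwise; $\mathbf{B}$ has $(u,v)$ entry $\frac{t-1}{\Delta}$ if $u\neq v$ both in $X$, $\frac{s-1}{\Delta}$ if $u\neq v$ both in $Y$, and $0$ otherwise. Then $\mathscr{L}=\frac{q}{q+1}\mathbf{A}-\frac{q^2}{q+1}\mathbf{B}-\frac{q^2}{q+1}\mathrm{diag}(\mathbf{y})+\frac{1}{q+1}\mathbf{I}$.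 $\mathds{1}_{s+t}$ is the all-ones vector and $\mathbf{I}$ the identity. -}

module Defs where

open import Level using (Level; _⊔_) renaming (suc to lsuc)
open import Data.Nat using (ℕ; zero; suc; _∸_; _<ᵇ_; _≤_)
open import Data.Bool using (Bool; true; false; if_then_else_; _xor_; _∧_; not; T)
open import Data.Fin using (Fin; toℕ; _≟_)
open import Data.Product using (_×_)
open import Relation.Nullary using (¬_)
open import Relation.Nullary.Decidable using (⌊_⌋)
open import Algebra.Bundles using (CommutativeRing)

record Field (c ℓ : Level) : Set (lsuc (c ⊔ ℓ)) where
  field
    commutativeRing : CommutativeRing c ℓ
  open CommutativeRing commutativeRing public
  field
    _⁻¹       : Carrier → Carrier
    0≉1       : ¬ (0# ≈ 1#)
    ⁻¹-inverse : ∀ x → ¬ (x ≈ 0#) → x * (x ⁻¹) ≈ 1#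

data Walk {n : ℕ} (adj : Fin n → Fin n → Bool) : Fin n → Fin n → ℕ → Set where
  here : ∀ {u} → Walk adj u u 0
  step : ∀ {u w v k} → T (adj u w) → Walk adj w v k → Walk adj u v (suc k)

IsDistance : {n : ℕ} → (Fin n → Fin n → Bool) → (Fin n → Fin n → ℕ) → Set
IsDistance {n} adj d =
  ∀ (u v : Fin n) → Walk adj u v (d u v) × (∀ k → Walk adj u v k → d u v ≤ k)

-- Complete bipartite graph K_{s,t} on Fin (s + t):
-- X = vertices with index < s (|X| = s), Y = the rest (|Y| = t).
inX : (s : ℕ) {n : ℕ} → Fin n → Bool
inX s i = toℕ i <ᵇ s

adjK : (s : ℕ) {n : ℕ} → Fin n → Fin n → Bool
adjK s u v = inX s u xor inX s v

module FieldNotions {c ℓ : Level} (F : Field c ℓ) where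
  open Field F

  ι : ℕ → Carrier
  ι zero    = 0#
  ι (suc n) = 1# + ι n

  -- q-integer [α] = 1 + q + ... + q^(α-1), [0] = 0
  qint : Carrier → ℕ → Carrier
  qint q zero    = 0#
  qint q (suc k) = 1# + q * qint q k

  _/_ : Carrier → Carrier → Carrier
  a / b = a * (b ⁻¹)

  sumF : (n : ℕ) → (Fin n → Carrier) → Carrier
  sumF zero    f = 0#
  sumF (suc n) f = f Fin.zero + sumF n (λ i → f (Fin.suc i))
    where import Data.Fin as Fin

  Matrix : ℕ → Set c
  Matrix n = Fin n → Fin n → Carrier

  _·_ : {n : ℕ} → Matrix n → Matrix n → Matrix n
  _·_ {n} M N i j = sumF n (λ k → M i k * N k j)

  _⊕_ : {n : ℕ} → Matrix n → Matrix n → Matrix n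
  (M ⊕ N) i j = M i j + N i j

  _⊖_ : {n : ℕ} → Matrix n → Matrix n → Matrix n
  (M ⊖ N) i j = M i j - N i j

  _⊙_ : {n : ℕ} → Carrier → Matrix n → Matrix n
  (a ⊙ M) i j = a * M i j

  idM : {n : ℕ} → Matrix n
  idM i j = if ⌊ i ≟ j ⌋ then 1# else 0#

  diag : {n : ℕ} → (Fin n → Carrier) → Matrix n
  diag y i j = if ⌊ i ≟ j ⌋ then y i else 0#

  outer : {n : ℕ} → (Fin n → Carrier) → (Fin n → Carrier) → Matrix n
  outer u v i j = u i * v j

  ones : {n : ℕ} → Fin n → Carrier
  ones _ = 1#

  qDist : {n : ℕ} → Carrier → (Fin n → Fin n → ℕ) → Matrix n
  qDist q d i j = qint q (d i j)

  module KData (s t : ℕ) (q : Carrier) where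
    Δ : Carrier
    Δ = q * q * ι (s ∸ 1) * ι (t ∸ 1) - 1#

    xv : {n : ℕ} → Fin n → Carrier
    xv v = if inX s v then (q * ι (t ∸ 1) - 1#) / ((q + 1#) * Δ)
                      else (q * ι (s ∸ 1) - 1#) / ((q + 1#) * Δ)

    yv : {n : ℕ} → Fin n → Carrier
    yv v = if inX s v then ι (t ∸ 1) / Δ else ι (s ∸ 1) / Δ

    AM : {n : ℕ} → Matrix n
    AM u v = if adjK s u v then 1# / Δ else 0#

    BM : {n : ℕ} → Matrix n
    BM u v = if ⌊ u ≟ v ⌋ then 0#
             else if inX s u ∧ inX s v then ι (t ∸ 1) / Δ
             else if not (inX s u) ∧ not (inX s v) then ι (s ∸ 1) / Δ
             else 0#

    LM : {n : ℕ} → Matrix n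
    LM = (((( q / (q + 1#)) ⊙ AM)
            ⊖ ((q * q / (q + 1#)) ⊙ BM))
            ⊖ ((q * q / (q + 1#)) ⊙ diag yv))
            ⊕ ((1# / (q + 1#)) ⊙ idM)

{-# OPTIONS --safe #-}

-- Write side i for inX s i (true iff i ∈ X). In K_{s,t} both 𝒟 and 𝓛 have the shape
-- M i j = P (side i) (side j) + e·δ i j for a 2×2 table P and a scalar e: distances are 0 on
-- the diagonal, 1 across the parts and 2 inside a part, so 𝒟 has e = −(1+q), while 𝓛 has
-- e = 1/(q+1). Such matrices are closed under products, the table of a product depending only
-- on the two tables, the two scalars and the part sizes s, t. Hence 𝒟𝓛 + I = 𝟙xᵀ reduces to
-- one polynomial identity per pair of sides in q, s−1, t−1, u = 1/(q+1) and w = 1/Δ, holding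
-- modulo Δw = 1, together with the vanishing of the diagonal coefficient 1 − (q+1)u.

module Submission where

open import Defs
open import Level using (Level; 0ℓ)
open import Data.Nat using (ℕ; zero; suc; _≥_; _∸_; s≤s; z≤n) renaming (_+_ to _+ℕ_)
import Data.Nat as ℕ
import Data.Nat.Properties as ℕ
open import Data.Integer as ℤ using (ℤ; +_; -[1+_]; _⊖_; _◃_; sign; ∣_∣)
open import Data.Integer.Properties using ([1+m]⊖[1+n]≡m⊖n; ◃-inverse)
open import Data.Sign as Sign using (Sign)
open import Data.Bool using (Bool; true; false; not; _xor_; T; if_then_else_)
open import Data.Bool.Properties using (xor-same; xor-inverseʳ; not-involutive)
open import Data.Fin using (Fin; zero; suc; _↑ʳ_; _≟_)
open import Data.Fin.Properties using (suc-injective)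
open import Data.Product using (Σ-syntax; _,_; proj₁; proj₂)
open import Data.Maybe as Maybe using (Maybe)
open import Data.Vec.N-ary using (N-ary)
open import Data.Empty using (⊥-elim)
open import Function using (_∘_)
open import Relation.Nullary using (¬_; yes; no)
open import Relation.Nullary.Decidable using (dec⇒maybe)
open import Relation.Binary.PropositionalEquality as ≡ using (_≡_; _≢_)
open import Algebra.Bundles using (CommutativeRing)
open import Algebra.Bundles.Raw using (RawRing)
open import Algebra.Solver.Ring.AlmostCommutativeRing
  using (fromCommutativeRing; _-Raw-AlmostCommutative⟶_)

-- Tactic.RingSolver cannot cancel x − x in a ring without decidable equality, so
-- Algebra.Solver.Ring is instantiated with ℤ coefficients through the canonical map ℤ → R.
module CommutativeRingSolver {c ℓ : Level} (R : CommutativeRing c ℓ) where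
  open CommutativeRing R
  open import Algebra.Properties.Ring ring using (-1*x≈-x)
  open import Algebra.Properties.AbelianGroup +-abelianGroup using (⁻¹-∙-comm)
  open import Algebra.Properties.Group +-group using (⁻¹-involutive; ε⁻¹≈ε)
  open import Algebra.Properties.CommutativeSemigroup *-commutativeSemigroup
    using (interchange)
  open import Algebra.Properties.CommutativeSemigroup +-commutativeSemigroup
    using () renaming (interchange to +-interchange)
  open import Algebra.Properties.Semiring.Mult.TCOptimised semiring
    using (_×_; 1+×; ×-homo-+; ×1-homo-*)
  open import Relation.Binary.Reasoning.Setoid setoid

  fromℤ : ℤ → Carrier
  fromℤ (+ n)    = n × 1#
  fromℤ -[1+ n ] = - (suc n × 1#)

  fromSign : Sign → Carrier
  fromSign Sign.+ = 1#
  fromSign Sign.- = - 1#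

  fromSign-* : ∀ σ τ → fromSign (σ Sign.* τ) ≈ fromSign σ * fromSign τ
  fromSign-* Sign.- Sign.- = sym (trans (-1*x≈-x (- 1#)) (⁻¹-involutive 1#))
  fromSign-* Sign.- Sign.+ = sym (*-identityʳ _)
  fromSign-* Sign.+ τ      = sym (*-identityˡ _)

  fromℤ-◃ : ∀ σ n → fromℤ (σ ◃ n) ≈ fromSign σ * (n × 1#)
  fromℤ-◃ σ      zero    = sym (zeroʳ _)
  fromℤ-◃ Sign.- (suc n) = sym (-1*x≈-x _)
  fromℤ-◃ Sign.+ (suc n) = sym (*-identityˡ _)

  fromℤ-signAbs : ∀ i → fromℤ i ≈ fromSign (sign i) * (∣ i ∣ × 1#)
  fromℤ-signAbs i =
    trans (reflexive (≡.cong fromℤ (≡.sym (◃-inverse i)))) (fromℤ-◃ (sign i) ∣ i ∣)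

  fromℤ-* : ∀ i j → fromℤ (i ℤ.* j) ≈ fromℤ i * fromℤ j
  fromℤ-* i j = begin
    fromℤ (sign i Sign.* sign j ◃ ∣ i ∣ ℕ.* ∣ j ∣)
      ≈⟨ fromℤ-◃ (sign i Sign.* sign j) (∣ i ∣ ℕ.* ∣ j ∣) ⟩
    fromSign (sign i Sign.* sign j) * ((∣ i ∣ ℕ.* ∣ j ∣) × 1#)
      ≈⟨ *-cong (fromSign-* (sign i) (sign j)) (×1-homo-* ∣ i ∣ ∣ j ∣) ⟩
    (fromSign (sign i) * fromSign (sign j)) * ((∣ i ∣ × 1#) * (∣ j ∣ × 1#))
      ≈⟨ interchange _ _ _ _ ⟩
    (fromSign (sign i) * (∣ i ∣ × 1#)) * (fromSign (sign j) * (∣ j ∣ × 1#))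
      ≈⟨ *-cong (fromℤ-signAbs i) (fromℤ-signAbs j) ⟨
    fromℤ i * fromℤ j
      ∎

  [x+y]-[x+z]≈y-z : ∀ x y z → (x + y) - (x + z) ≈ y - z
  [x+y]-[x+z]≈y-z x y z = begin
    (x + y) - (x + z)        ≈⟨ +-congˡ (⁻¹-∙-comm x z) ⟨
    (x + y) + (- x + - z)    ≈⟨ +-interchange _ _ _ _ ⟩
    (x - x) + (y - z)        ≈⟨ +-congʳ (-‿inverseʳ x) ⟩
    0# + (y - z)             ≈⟨ +-identityˡ _ ⟩
    y - z                    ∎

  fromℤ-⊖ : ∀ m n → fromℤ (m ⊖ n) ≈ m × 1# - n × 1#
  fromℤ-⊖ m       zero    = sym (trans (+-congˡ ε⁻¹≈ε) (+-identityʳ _))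
  fromℤ-⊖ zero    (suc n) = sym (+-identityˡ _)
  fromℤ-⊖ (suc m) (suc n) = begin
    fromℤ (suc m ⊖ suc n)            ≡⟨ ≡.cong fromℤ ([1+m]⊖[1+n]≡m⊖n m n) ⟩
    fromℤ (m ⊖ n)                    ≈⟨ fromℤ-⊖ m n ⟩
    m × 1# - n × 1#                  ≈⟨ [x+y]-[x+z]≈y-z 1# (m × 1#) (n × 1#) ⟨
    (1# + m × 1#) - (1# + n × 1#)    ≈⟨ +-cong (1+× m 1#) (-‿cong (1+× n 1#)) ⟨
    suc m × 1# - suc n × 1#          ∎

  fromℤ-+ : ∀ i j → fromℤ (i ℤ.+ j) ≈ fromℤ i + fromℤ j
  fromℤ-+ (+ m)    (+ n)    = ×-homo-+ 1# m n
  fromℤ-+ (+ m)    -[1+ n ] = fromℤ-⊖ m (suc n)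
  fromℤ-+ -[1+ m ] (+ n)    = trans (fromℤ-⊖ n (suc m)) (+-comm _ _)
  fromℤ-+ -[1+ m ] -[1+ n ] = begin
    - (suc (suc (m ℕ.+ n)) × 1#)        ≡⟨ ≡.cong (λ k → - (suc k × 1#)) (ℕ.+-suc m n) ⟨
    - ((suc m ℕ.+ suc n) × 1#)          ≈⟨ -‿cong (×-homo-+ 1# (suc m) (suc n)) ⟩
    - (suc m × 1# + suc n × 1#)         ≈⟨ ⁻¹-∙-comm _ _ ⟨
    - (suc m × 1#) + - (suc n × 1#)     ∎

  fromℤ-neg : ∀ i → fromℤ (ℤ.- i) ≈ - fromℤ i
  fromℤ-neg (+ zero)  = sym ε⁻¹≈ε
  fromℤ-neg (+ suc n) = refl
  fromℤ-neg -[1+ n ]  = sym (⁻¹-involutive _)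

  fromℤ-homomorphism : ℤ.+-*-rawRing -Raw-AlmostCommutative⟶ fromCommutativeRing R
  fromℤ-homomorphism = record
    { ⟦_⟧    = fromℤ
    ; +-homo = fromℤ-+
    ; *-homo = fromℤ-*
    ; -‿homo = fromℤ-neg
    ; 0-homo = refl
    ; 1-homo = refl
    }

  fromℤ-≟ : ∀ i j → Maybe (fromℤ i ≈ fromℤ j)
  fromℤ-≟ i j = Maybe.map (reflexive ∘ ≡.cong fromℤ) (dec⇒maybe (i ℤ.≟ j))

  open import Algebra.Solver.Ring ℤ.+-*-rawRing (fromCommutativeRing R) fromℤ-homomorphism fromℤ-≟
    public

  polynomialRawRing : ℕ → RawRing 0ℓ 0ℓ
  polynomialRawRing n = record
    { Carrier = Polynomial n
    ; _≈_     = _≡_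
    ; _+_     = _:+_
    ; _*_     = _:*_
    ; -_      = :-_
    ; 0#      = con (+ 0)
    ; 1#      = con (+ 1)
    }

module FieldProperties {c ℓ : Level} (F : Field c ℓ) where
  open Field F
  open import Algebra.Properties.CommutativeSemigroup *-commutativeSemigroup
    using (interchange)
  open import Relation.Binary.Reasoning.Setoid setoid

  *≈1⇒≉0 : ∀ {x y} → x * y ≈ 1# → ¬ x ≈ 0#
  *≈1⇒≉0 {x} {y} xy≈1 x≈0 = 0≉1 (begin
    0#     ≈⟨ zeroˡ y ⟨
    0# * y ≈⟨ *-congʳ x≈0 ⟨
    x * y  ≈⟨ xy≈1 ⟩
    1#     ∎)

  ⁻¹-unique : ∀ {x y} → x * y ≈ 1# → y ≈ x ⁻¹
  ⁻¹-unique {x} {y} xy≈1 = begin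
    y                ≈⟨ *-identityʳ y ⟨
    y * 1#           ≈⟨ *-congˡ (⁻¹-inverse x (*≈1⇒≉0 xy≈1)) ⟨
    y * (x * x ⁻¹)   ≈⟨ *-assoc y x (x ⁻¹) ⟨
    (y * x) * x ⁻¹   ≈⟨ *-congʳ (trans (*-comm y x) xy≈1) ⟩
    1# * x ⁻¹        ≈⟨ *-identityˡ (x ⁻¹) ⟩
    x ⁻¹             ∎

  ⁻¹-distrib-* : ∀ {x y} → ¬ x ≈ 0# → ¬ y ≈ 0# → (x * y) ⁻¹ ≈ x ⁻¹ * y ⁻¹
  ⁻¹-distrib-* {x} {y} x≉0 y≉0 = sym (⁻¹-unique (begin
    (x * y) * (x ⁻¹ * y ⁻¹)      ≈⟨ interchange x y (x ⁻¹) (y ⁻¹) ⟩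
    (x * x ⁻¹) * (y * y ⁻¹)      ≈⟨ *-cong (⁻¹-inverse x x≉0) (⁻¹-inverse y y≉0) ⟩
    1# * 1#                      ≈⟨ *-identityˡ 1# ⟩
    1#                           ∎))

module _ {n : ℕ} {adj : Fin n → Fin n → Bool} where

  walk₀-endpoints : ∀ {u v} → Walk adj u v 0 → u ≡ v
  walk₀-endpoints here = ≡.refl

  walk₁-adjacent : ∀ {u v} → Walk adj u v 1 → T (adj u v)
  walk₁-adjacent (step uv here) = uv

  module _ {d : Fin n → Fin n → ℕ} (isDistance : IsDistance adj d) where

    distance-refl : ∀ u → d u u ≡ 0
    distance-refl u = ℕ.n≤0⇒n≡0 (proj₂ (isDistance u u) 0 here)

    distance-adjacent : ∀ {u v} → u ≢ v → T (adj u v) → d u v ≡ 1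
    distance-adjacent {u} {v} u≢v uv
      with d u v | proj₁ (isDistance u v) | proj₂ (isDistance u v) 1 (step uv here)
    ... | zero        | walk | _ = ⊥-elim (u≢v (walk₀-endpoints walk))
    ... | suc zero    | _    | _ = ≡.refl
    ... | suc (suc _) | _    | s≤s ()

    distance-commonNeighbour : ∀ {u w v} → u ≢ v → adj u v ≡ false →
                               T (adj u w) → T (adj w v) → d u v ≡ 2
    distance-commonNeighbour {u} {w} {v} u≢v ¬uv uw wv
      with d u v | proj₁ (isDistance u v) | proj₂ (isDistance u v) 2 (step uw (step wv here))
    ... | zero              | walk | _ = ⊥-elim (u≢v (walk₀-endpoints walk))
    ... | suc zero          | walk | _ = ⊥-elim (≡.subst T ¬uv (walk₁-adjacent walk))
    ... | suc (suc zero)    | _    | _ = ≡.refl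
    ... | suc (suc (suc _)) | _    | s≤s (s≤s ())

inX-↑ʳ : ∀ s {m} (i : Fin m) → inX s (s ↑ʳ i) ≡ false
inX-↑ʳ zero    i = ≡.refl
inX-↑ʳ (suc s) i = inX-↑ʳ s i

otherSide : ∀ s t (b : Bool) → Σ[ w ∈ Fin (suc s +ℕ suc t) ] inX (suc s) w ≡ not b
otherSide s t true  = suc s ↑ʳ zero , inX-↑ʳ (suc s) zero
otherSide s t false = zero , ≡.refl

adjK-sameSide : ∀ s {n} (u v : Fin n) {b} → inX s u ≡ b → inX s v ≡ b → adjK s u v ≡ false
adjK-sameSide s u v {b} u∈b v∈b rewrite u∈b | v∈b = xor-same b

adjK-otherSide : ∀ s {n} (u v : Fin n) {b} → inX s u ≡ b → inX s v ≡ not b → T (adjK s u v)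
adjK-otherSide s u v {b} u∈b v∉b rewrite u∈b | v∉b = ≡.subst T (≡.sym (xor-inverseʳ b)) _

module _ {s t : ℕ} {d : Fin (suc s +ℕ suc t) → Fin (suc s +ℕ suc t) → ℕ}
         (isDistance : IsDistance (adjK (suc s)) d) where

  distanceK-sameSide : ∀ {u v b} → u ≢ v → inX (suc s) u ≡ b → inX (suc s) v ≡ b → d u v ≡ 2
  distanceK-sameSide {u} {v} {b} u≢v u∈b v∈b with otherSide s t b
  ... | w , w∉b = distance-commonNeighbour isDistance {w = w} u≢v
                    (adjK-sameSide (suc s) u v u∈b v∈b)
                    (adjK-otherSide (suc s) u w u∈b w∉b)
                    (adjK-otherSide (suc s) w v w∉b (≡.trans v∈b (≡.sym (not-involutive b))))

  distanceK-otherSide : ∀ {u v b} → u ≢ v → inX (suc s) u ≡ b → inX (suc s) v ≡ not b →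
                        d u v ≡ 1
  distanceK-otherSide {u} {v} u≢v u∈b v∉b =
    distance-adjacent isDistance u≢v (adjK-otherSide (suc s) u v u∈b v∉b)

module BlockFormulas {a ℓ′ : Level} (R : RawRing a ℓ′) where
  open RawRing R

  blockProduct : Carrier → Carrier → (Bool → Bool → Carrier) → Carrier →
                 (Bool → Bool → Carrier) → Carrier → Bool → Bool → Carrier
  blockProduct m n P e Q f a b =
    m * (P a true * Q true b) + n * (P a false * Q false b) + e * Q a b + f * P a b

module BlockMatrices {c ℓ : Level} (F : Field c ℓ) where
  open Field F hiding (zero)
  open FieldNotions F
  open BlockFormulas rawRing public
  open CommutativeRingSolver commutativeRing using (solve; _:=_; _:+_; _:*_; con)
  open import Algebra.Properties.CommutativeSemigroup +-commutativeSemigroup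
    using () renaming (interchange to +-interchange)
  open import Relation.Binary.Reasoning.Setoid setoid

  sumF-cong : ∀ n {f g : Fin n → Carrier} → (∀ k → f k ≈ g k) → sumF n f ≈ sumF n g
  sumF-cong zero    f≈g = refl
  sumF-cong (suc n) f≈g = +-cong (f≈g zero) (sumF-cong n (f≈g ∘ suc))

  sumF-+ : ∀ n (f g : Fin n → Carrier) → sumF n (λ k → f k + g k) ≈ sumF n f + sumF n g
  sumF-+ zero    f g = sym (+-identityˡ 0#)
  sumF-+ (suc n) f g = trans (+-congˡ (sumF-+ n (f ∘ suc) (g ∘ suc))) (+-interchange _ _ _ _)

  sumF-const : ∀ n x → sumF n (λ _ → x) ≈ ι n * x
  sumF-const zero    x = sym (zeroˡ x)
  sumF-const (suc n) x = begin
    x + sumF n (λ _ → x)  ≈⟨ +-cong (sym (*-identityˡ x)) (sumF-const n x) ⟩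
    1# * x + ι n * x      ≈⟨ distribʳ x 1# (ι n) ⟨
    (1# + ι n) * x        ∎

  sumF-single : ∀ n (f : Fin n → Carrier) i → (∀ k → k ≢ i → f k ≈ 0#) → sumF n f ≈ f i
  sumF-single (suc n) f zero    vanish = begin
    f zero + sumF n (f ∘ suc)     ≈⟨ +-congˡ (sumF-cong n (λ k → vanish (suc k) λ ())) ⟩
    f zero + sumF n (λ _ → 0#)    ≈⟨ +-congˡ (trans (sumF-const n 0#) (zeroʳ (ι n))) ⟩
    f zero + 0#                   ≈⟨ +-identityʳ (f zero) ⟩
    f zero                        ∎
  sumF-single (suc n) f (suc i) vanish = begin
    f zero + sumF n (f ∘ suc)     ≈⟨ +-cong (vanish zero λ ()) (sumF-single n (f ∘ suc) i vanish-suc) ⟩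
    0# + f (suc i)                ≈⟨ +-identityˡ (f (suc i)) ⟩
    f (suc i)                     ∎
    where
    vanish-suc : ∀ k → k ≢ i → f (suc k) ≈ 0#
    vanish-suc k k≢i = vanish (suc k) (k≢i ∘ suc-injective)

  idM-diag : ∀ {n} (i : Fin n) → idM i i ≈ 1#
  idM-diag i with i ≟ i
  ... | yes _  = refl
  ... | no i≢i = ⊥-elim (i≢i ≡.refl)

  idM-offDiag : ∀ {n} {i j : Fin n} → i ≢ j → idM i j ≈ 0#
  idM-offDiag {i = i} {j} i≢j with i ≟ j
  ... | yes i≡j = ⊥-elim (i≢j i≡j)
  ... | no _    = refl

  sumF-idMˡ : ∀ n i (g : Fin n → Carrier) → sumF n (λ k → idM i k * g k) ≈ g i
  sumF-idMˡ n i g = begin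
    sumF n (λ k → idM i k * g k)  ≈⟨ sumF-single n _ i vanish ⟩
    idM i i * g i                 ≈⟨ trans (*-congʳ (idM-diag i)) (*-identityˡ (g i)) ⟩
    g i                           ∎
    where
    vanish : ∀ k → k ≢ i → idM i k * g k ≈ 0#
    vanish k k≢i = trans (*-congʳ (idM-offDiag (k≢i ∘ ≡.sym))) (zeroˡ (g k))

  sumF-idMʳ : ∀ n j (g : Fin n → Carrier) → sumF n (λ k → g k * idM k j) ≈ g j
  sumF-idMʳ n j g = begin
    sumF n (λ k → g k * idM k j)  ≈⟨ sumF-single n _ j vanish ⟩
    g j * idM j j                 ≈⟨ trans (*-congˡ (idM-diag j)) (*-identityʳ (g j)) ⟩
    g j                           ∎
    where
    vanish : ∀ k → k ≢ j → g k * idM k j ≈ 0#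
    vanish k k≢j = trans (*-congˡ (idM-offDiag k≢j)) (zeroʳ (g k))

  sumF-sides : ∀ s t (G : Bool → Carrier) →
               sumF (s +ℕ t) (λ k → G (inX s k)) ≈ ι s * G true + ι t * G false
  sumF-sides zero    t G = begin
    sumF t (λ _ → G false)        ≈⟨ sumF-const t (G false) ⟩
    ι t * G false                 ≈⟨ +-identityˡ _ ⟨
    0# + ι t * G false            ≈⟨ +-congʳ (zeroˡ (G true)) ⟨
    0# * G true + ι t * G false   ∎
  sumF-sides (suc s) t G = begin
    G true + sumF (s +ℕ t) (λ k → G (inX s k))  ≈⟨ +-congˡ (sumF-sides s t G) ⟩
    G true + (ι s * G true + ι t * G false)     ≈⟨ regroup (G true) (ι s) (G false) (ι t) ⟩
    (1# + ι s) * G true + ι t * G false         ∎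
    where
    regroup : ∀ x m y n → x + (m * x + n * y) ≈ (1# + m) * x + n * y
    regroup = solve 4 (λ x m y n →
      x :+ (m :* x :+ n :* y) := (con (+ 1) :+ m) :* x :+ n :* y) refl

  IsBlock : ℕ → ∀ {n} → Matrix n → (Bool → Bool → Carrier) → Carrier → Set ℓ
  IsBlock s M P e = ∀ i j → M i j ≈ P (inX s i) (inX s j) + e * idM i j

  ·-block : ∀ s t {M N : Matrix (s +ℕ t)} {P Q e f} → IsBlock s M P e → IsBlock s N Q f →
            IsBlock s (M · N) (blockProduct (ι s) (ι t) P e Q f) (e * f)
  ·-block s t {M} {N} {P} {Q} {e} {f} M-block N-block i j = begin
    sumF n (λ k → M i k * N k j)
      ≈⟨ sumF-cong n (λ k → *-cong (M-block i k) (N-block k j)) ⟩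
    sumF n (λ k → (P a (side k) + e * idM i k) * (Q (side k) b + f * idM k j))
      ≈⟨ sumF-cong n (λ k → expand (P a (side k)) e (idM i k) (Q (side k) b) f (idM k j)) ⟩
    sumF n (λ k → ((A k + B k) + C k) + D k)
      ≈⟨ trans (sumF-+ n _ D) (+-congʳ (trans (sumF-+ n _ C) (+-congʳ (sumF-+ n A B)))) ⟩
    ((sumF n A + sumF n B) + sumF n C) + sumF n D
      ≈⟨ +-cong (+-cong (+-cong (sumF-sides s t (λ c → P a c * Q c b))
                                (sumF-idMˡ n i (λ k → e * Q (side k) b)))
                        (sumF-idMʳ n j (λ k → f * P a (side k))))
                (sumF-idMˡ n i (λ k → idM k j * (e * f))) ⟩
    blockProduct (ι s) (ι t) P e Q f a b + idM i j * (e * f)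
      ≈⟨ +-congˡ (*-comm (idM i j) (e * f)) ⟩
    blockProduct (ι s) (ι t) P e Q f a b + (e * f) * idM i j
      ∎
    where
    n : ℕ
    n = s +ℕ t
    side : Fin n → Bool
    side = inX s
    a b : Bool
    a = side i
    b = side j
    A B C D : Fin n → Carrier
    A k = P a (side k) * Q (side k) b
    B k = idM i k * (e * Q (side k) b)
    C k = (f * P a (side k)) * idM k j
    D k = idM i k * (idM k j * (e * f))
    expand : ∀ p e x r f y →
      (p + e * x) * (r + f * y) ≈ ((p * r + x * (e * r)) + (f * p) * y) + x * (y * (e * f))
    expand = solve 6 (λ p e x r f y →
      (p :+ e :* x) :* (r :+ f :* y)
        := ((p :* r :+ x :* (e :* r)) :+ (f :* p) :* y) :+ x :* (y :* (e :* f))) refl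

-- The tables of the block forms of 𝒟, 𝓛, 𝒟𝓛 and of x, over an arbitrary raw ring so that the
-- ring solver can be fed the same definitions. The parameters stand for q, s − 1, t − 1,
-- u = 1/(q+1) and w = 1/Δ; a Boolean is a side, true meaning X.
module KstTables {a ℓ′ : Level} (R : RawRing a ℓ′) (q s₁ t₁ u w : RawRing.Carrier R) where
  open RawRing R
  open BlockFormulas R

  infixl 6 _-_
  _-_ : Carrier → Carrier → Carrier
  x - y = x + - y

  Δ : Carrier
  Δ = q * q * s₁ * t₁ - 1#

  qDistTable : Bool → Bool → Carrier
  qDistTable a b = if a xor b then 1# else 1# + q

  LMTable : Bool → Bool → Carrier
  LMTable a b = if a xor b then (q * u) * (1# * w)
                else - ((q * (q * u)) * (if b then t₁ * w else s₁ * w))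

  xvTable : Bool → Carrier
  xvTable b = (if b then q * t₁ - 1# else q * s₁ - 1#) * (u * w)

  productTable : Bool → Bool → Carrier
  productTable = blockProduct (1# + s₁) (1# + t₁) qDistTable (- (1# + q)) LMTable (1# * u)

module KstTableIdentity {c ℓ : Level} (F : Field c ℓ) where
  open Field F hiding (zero)
  open CommutativeRingSolver commutativeRing
    using (solve; Polynomial; _:=_; _:+_; _:*_; _:-_; con; polynomialRawRing)
  open import Data.Product using (_×_)

  equation : Bool → Bool → N-ary 5 (Polynomial 5) (Polynomial 5 × Polynomial 5)
  equation a b q s₁ t₁ u w =
    productTable a b := xvTable b :+ ((con (+ 1) :* u) :* qDistTable a b) :* (con (+ 1) :- Δ :* w)
    where open KstTables (polynomialRawRing 5) q s₁ t₁ u w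

  productTable≈xvTable+c[1-Δw] : ∀ (q s₁ t₁ u w : Carrier) a b →
    let open KstTables rawRing q s₁ t₁ u w using (Δ; qDistTable; xvTable; productTable)
    in productTable a b ≈ xvTable b + ((1# * u) * qDistTable a b) * (1# - Δ * w)
  productTable≈xvTable+c[1-Δw] q s₁ t₁ u w true  true  = solve 5 (equation true true) refl q s₁ t₁ u w
  productTable≈xvTable+c[1-Δw] q s₁ t₁ u w true  false = solve 5 (equation true false) refl q s₁ t₁ u w
  productTable≈xvTable+c[1-Δw] q s₁ t₁ u w false true  = solve 5 (equation false true) refl q s₁ t₁ u w
  productTable≈xvTable+c[1-Δw] q s₁ t₁ u w false false = solve 5 (equation false false) refl q s₁ t₁ u w

module BipartiteQDistance {c ℓ : Level} (F : Field c ℓ) (s t : ℕ) (q : Field.Carrier F) where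
  open Field F hiding (zero)
  open FieldNotions F
  open FieldProperties F
  open BlockMatrices F
  open KstTableIdentity F
  open KData (suc s) (suc t) q
  open CommutativeRingSolver commutativeRing using (solve; _:=_; _:+_; _:*_; _:-_; :-_; con)
  open import Algebra.Properties.Group +-group using (inverseˡ-unique; x∙y⁻¹≈ε⇒x≈y)
  open import Relation.Binary.Reasoning.Setoid setoid

  u w : Carrier
  u = (q + 1#) ⁻¹
  w = Δ ⁻¹

  open KstTables rawRing q (ι s) (ι t) u w using (qDistTable; LMTable; xvTable; productTable)

  qint-diagonal : ∀ a → qint q 0 ≈ qDistTable a a + (- (1# + q)) * 1#
  qint-diagonal a = begin
    0#                                  ≈⟨ -‿inverseʳ (1# + q) ⟨
    (1# + q) - (1# + q)                 ≈⟨ +-cong (qDistTable-diag a) (*-identityʳ _) ⟨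
    qDistTable a a + (- (1# + q)) * 1#  ∎
    where
    qDistTable-diag : ∀ a → qDistTable a a ≈ 1# + q
    qDistTable-diag true  = refl
    qDistTable-diag false = refl

  qint-otherSide : qint q 1 ≈ 1# + (- (1# + q)) * 0#
  qint-otherSide = +-congˡ (trans (zeroʳ q) (sym (zeroʳ _)))

  qint-sameSide : qint q 2 ≈ (1# + q) + (- (1# + q)) * 0#
  qint-sameSide = solve 1 (λ q →
    con (+ 1) :+ q :* (con (+ 1) :+ q :* con (+ 0))
      := (con (+ 1) :+ q) :+ (:- (con (+ 1) :+ q)) :* con (+ 0)) refl q

  qDist-block : ∀ {d} → IsDistance (adjK (suc s)) d →
                IsBlock (suc s) (qDist q d) qDistTable (- (1# + q))
  qDist-block isD i j with i ≟ j
  ... | yes ≡.refl rewrite distance-refl isD i = qint-diagonal (inX (suc s) i)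
  ... | no i≢j with inX (suc s) i in i∈ | inX (suc s) j in j∈
  ...   | true  | true  rewrite distanceK-sameSide  {t = t} isD i≢j i∈ j∈ = qint-sameSide
  ...   | false | false rewrite distanceK-sameSide  {t = t} isD i≢j i∈ j∈ = qint-sameSide
  ...   | true  | false rewrite distanceK-otherSide {t = t} isD i≢j i∈ j∈ = qint-otherSide
  ...   | false | true  rewrite distanceK-otherSide {t = t} isD i≢j i∈ j∈ = qint-otherSide

  LM-diagonal : ∀ p r y v → ((p * 0# - r * 0#) - r * y) + v * 1# ≈ - (r * y) + v * 1#
  LM-diagonal = solve 4 (λ p r y v →
    ((p :* con (+ 0) :- r :* con (+ 0)) :- r :* y) :+ v :* con (+ 1)
      := :- (r :* y) :+ v :* con (+ 1)) refl

  LM-sameSide : ∀ p r y v → ((p * 0# - r * y) - r * 0#) + v * 0# ≈ - (r * y) + v * 0#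
  LM-sameSide = solve 4 (λ p r y v →
    ((p :* con (+ 0) :- r :* y) :- r :* con (+ 0)) :+ v :* con (+ 0)
      := :- (r :* y) :+ v :* con (+ 0)) refl

  LM-otherSide : ∀ p r z v → ((p * z - r * 0#) - r * 0#) + v * 0# ≈ p * z + v * 0#
  LM-otherSide = solve 4 (λ p r z v →
    ((p :* z :- r :* con (+ 0)) :- r :* con (+ 0)) :+ v :* con (+ 0)
      := p :* z :+ v :* con (+ 0)) refl

  LM-block : IsBlock (suc s) (LM {suc s +ℕ suc t}) LMTable (1# / (q + 1#))
  LM-block i j with i ≟ j
  ... | yes ≡.refl with inX (suc s) i
  ...   | true  = LM-diagonal _ _ _ _
  ...   | false = LM-diagonal _ _ _ _
  LM-block i j | no _ with inX (suc s) i | inX (suc s) j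
  ... | true  | true  = LM-sameSide _ _ _ _
  ... | false | false = LM-sameSide _ _ _ _
  ... | true  | false = LM-otherSide _ _ _ _
  ... | false | true  = LM-otherSide _ _ _ _

  q+1≉0 : ¬ q ≈ - 1# → ¬ q + 1# ≈ 0#
  q+1≉0 q≉-1 = q≉-1 ∘ inverseˡ-unique q 1#

  Δ≉0 : ¬ q * q * ι s * ι t ≈ 1# → ¬ Δ ≈ 0#
  Δ≉0 qqst≉1 = qqst≉1 ∘ x∙y⁻¹≈ε⇒x≈y _ 1#

  productTable≈xvTable : ¬ Δ ≈ 0# → ∀ a b → productTable a b ≈ xvTable b
  productTable≈xvTable Δ≉0 a b = begin
    productTable a b
      ≈⟨ productTable≈xvTable+c[1-Δw] q (ι s) (ι t) u w a b ⟩
    xvTable b + ((1# * u) * qDistTable a b) * (1# - Δ * w)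
      ≈⟨ +-congˡ (*-congˡ (+-congˡ (-‿cong (⁻¹-inverse Δ Δ≉0)))) ⟩
    xvTable b + ((1# * u) * qDistTable a b) * (1# - 1#)
      ≈⟨ +-congˡ (trans (*-congˡ (-‿inverseʳ 1#)) (zeroʳ _)) ⟩
    xvTable b + 0#
      ≈⟨ +-identityʳ (xvTable b) ⟩
    xvTable b
      ∎

  diagonal-vanishes : ¬ q + 1# ≈ 0# → ∀ δ → (- (1# + q)) * (1# / (q + 1#)) * δ + δ ≈ 0#
  diagonal-vanishes q+1≉0 δ = begin
    (- (1# + q)) * (1# * u) * δ + δ    ≈⟨ regroup q u δ ⟩
    (1# - (q + 1#) * u) * δ            ≈⟨ *-congʳ (+-congˡ (-‿cong (⁻¹-inverse (q + 1#) q+1≉0))) ⟩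
    (1# - 1#) * δ                      ≈⟨ trans (*-congʳ (-‿inverseʳ 1#)) (zeroˡ δ) ⟩
    0#                                 ∎
    where
    regroup : ∀ q u δ → (- (1# + q)) * (1# * u) * δ + δ ≈ (1# - (q + 1#) * u) * δ
    regroup = solve 3 (λ q u δ →
      :- (con (+ 1) :+ q) :* (con (+ 1) :* u) :* δ :+ δ
        := (con (+ 1) :- (q :+ con (+ 1)) :* u) :* δ) refl

  xv≈xvTable : ¬ q + 1# ≈ 0# → ¬ Δ ≈ 0# →
               ∀ (j : Fin (suc s +ℕ suc t)) → xv j ≈ xvTable (inX (suc s) j)
  xv≈xvTable q+1≉0 Δ≉0 j with inX (suc s) j
  ... | true  = *-congˡ (⁻¹-distrib-* q+1≉0 Δ≉0)
  ... | false = *-congˡ (⁻¹-distrib-* q+1≉0 Δ≉0)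

  qDistLM+I≈1x : ¬ q ≈ - 1# → ¬ q * q * ι s * ι t ≈ 1# →
                 ∀ {d} → IsDistance (adjK (suc s)) d →
                 ∀ i j → ((qDist q d · LM) ⊕ idM) i j ≈ outer ones xv i j
  qDistLM+I≈1x q≉-1 qqst≉1 {d} isD i j = begin
    (qDist q d · LM) i j + idM i j
      ≈⟨ +-congʳ (·-block (suc s) (suc t) {P = qDistTable} {Q = LMTable}
                          (qDist-block isD) LM-block i j) ⟩
    (productTable a b + e * idM i j) + idM i j
      ≈⟨ +-assoc _ _ _ ⟩
    productTable a b + (e * idM i j + idM i j)
      ≈⟨ +-cong (productTable≈xvTable (Δ≉0 qqst≉1) a b)
                (diagonal-vanishes (q+1≉0 q≉-1) (idM i j)) ⟩
    xvTable b + 0#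
      ≈⟨ +-identityʳ (xvTable b) ⟩
    xvTable b
      ≈⟨ xv≈xvTable (q+1≉0 q≉-1) (Δ≉0 qqst≉1) j ⟨
    xv j
      ≈⟨ *-identityˡ (xv j) ⟨
    1# * xv j
      ∎
    where
    a b : Bool
    a = inX (suc s) i
    b = inX (suc s) j
    e : Carrier
    e = (- (1# + q)) * (1# / (q + 1#))

lemma5p7 : ∀ {c ℓ : Level} (F : Field c ℓ) →
  let open Field F
      open FieldNotions F
  in ∀ (s t : ℕ) → s ≥ 1 → t ≥ 1 → (q : Carrier) →
     ¬ (q ≈ - 1#) →
     ¬ (q * q * ι (s ∸ 1) * ι (t ∸ 1) ≈ 1#) →
     ¬ ((q + 1#) * (q + 1#) * ι (s ∸ 1) * ι (t ∸ 1) ≈ ι s * ι t) →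
     (d : Fin (s +ℕ t) → Fin (s +ℕ t) → ℕ) → IsDistance (adjK s) d →
     let open KData s t q
     in ∀ (i j : Fin (s +ℕ t)) →
        ((qDist q d · LM) ⊕ idM) i j ≈ outer ones xv i j
lemma5p7 F (suc s) (suc t) (s≤s z≤n) (s≤s z≤n) q q≉-1 qqst≉1 _ d isDistance =
  BipartiteQDistance.qDistLM+I≈1x F s t q q≉-1 qqst≉1 isDistance
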